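{- Let $M$ be a two-counter machine. For all strings $s,s'\in\mathcal{S}\Sigma_M$ with $s\to_{R_M}s'$, there exist $n,m\in\mathbb{N}$ and $q\in Q_M$ such that $s=a^nb^mq$ (so $s\le C_M$) and $s'=[\![\iota(q)]\!]_f(n,m)$, where $[\![i]\!]_f:\mathbb{N}\times\mathbb{N}\to\mathcal{S}\Sigma_M$ is given by $[\![\mathrm{Inc}(1,q')]\!]_f(n,m)=a^{n+1}b^mq'$; $[\![\mathrm{Inc}(2,q')]\!]_f(n,m)=a^nb^{m+1}q'$; $[\![\mathrm{If}(1,q_1,q_2)]\!]_f(n,m)=a^nb^mq_1$ if $n=0$ and $=a^pb^mq_2$ if $n=p+1$; $[\![\mathrm{If}(2,q_1,q_2)]\!]_f(n,m)=a^nb^mq_1$ if $m=0$ and $=a^nb^pq_2$ if $m=p+1$; $[\![\mathrm{Halt}(x)]\!]_f(n,m)=c_x$. In particular, $\to_{R_M}$ is a partial functional relation on configurations.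
   Context: Pre-Kleene algebra: constants $0,1$, operations $+,\cdot,{}^*$ with $(+,0)$ a commutative idempotent monoid, $(\cdot,1)$ a monoid, two-sided distributivity, $0$ absorbing, and $x^*=1+xx^*$; order $x\le y$ iff $x+y=y$. A commutable set is a set with a reflexive symmetric relation $\sim$ (discrete if $\sim$ is equality). $\mathcal{S}Y$: strings over $Y$ modulo $xy=yx$ for $x\sim y$; $\mathcal{T}Y$: free pre-Kleene algebra on $Y$ subject to $xy=yx$ for $x\sim y$. $\ddot Y=\{y_l\}\cup\{y_r\}$ ($y\in Y$) with $y_l\sim y'_r$ always, $y_l\sim y'_l$ iff $y\sim y'$, $y_r\sim y'_r$ iff $y\sim y'$; $(-)_l,(-)_r:\mathcal{T}Y\to\mathcal{T}\ddot Y$ send $y$ to $y_l$, resp. $y_r$. For strings $s,s'$ over $Y$ and $e\in\mathcal{T}\ddot Y$, $s\to_e s'$ means $s_ls'_r\le e$. A two-counter machine $M=(Q_M,\dot q,\iota)$: finite state set $Q_M$, initial state $\dot q$, $\iota:Q_M\to I_M$ with instructions $\mathrm{Inc}(r,q)$, $\mathrm{If}(r,q,q')$ ($r\in\{1,2\}$), $\mathrm{Halt}(x)$ ($x\in\{0,1\}$). $\Sigma_M=Q_M\uplus\{a,b,c_0,c_1\}$ discrete; $C_M=a^*b^*Q_M\in\mathcal{T}\Sigma_M$ (with $Q_M$ standing for the sum of its elements). In $\mathcal{T}\ddot\Sigma_M$: $[\![\mathrm{Inc}(1,q)]\!]=a_r(a_la_r)^*(b_lb_r)^*q_r$, $[\![\mathrm{Inc}(2,q)]\!]=(a_la_r)^*b_r(b_lb_r)^*q_r$,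 $[\![\mathrm{If}(1,q_1,q_2)]\!]=(b_lb_r)^*(q_1)_r+a_l(a_la_r)^*(b_lb_r)^*(q_2)_r$, $[\![\mathrm{If}(2,q_1,q_2)]\!]=(a_la_r)^*(q_1)_r+(a_la_r)^*b_l(b_lb_r)^*(q_2)_r$, $[\![\mathrm{Halt}(x)]\!]=(c_x)_r$; $R_M=\sum_{q\in Q_M}[\![\iota(q)]\!]q_l$. -}

module Defs where

open import Data.Nat using (ℕ; zero; suc; _+_)
open import Data.Fin using (Fin)
open import Data.List using (List; []; _∷_; _++_; replicate)
open import Relation.Binary.PropositionalEquality using (_≡_)

data Term (Y : Set) : Set where
  gen  : Y → Term Y
  𝟘 𝟙  : Term Y
  _⊕_  : Term Y → Term Y → Term Y
  _⊙_  : Term Y → Term Y → Term Y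
  _⋆   : Term Y → Term Y

infixl 6 _⊕_
infixl 7 _⊙_
infix 8 _⋆

-- The least congruence containing the pre-Kleene algebra axioms and
-- xy = yx for commuting generators x ∼ y.  𝒯Y is Term Y modulo _≈_.
module _ {Y : Set} (_∼_ : Y → Y → Set) where
  infix 4 _≈_
  data _≈_ : Term Y → Term Y → Set where
    ≈-refl  : ∀ {x} → x ≈ x
    ≈-sym   : ∀ {x y} → x ≈ y → y ≈ x
    ≈-trans : ∀ {x y z} → x ≈ y → y ≈ z → x ≈ z
    ⊕-cong  : ∀ {x x' y y'} → x ≈ x' → y ≈ y' → x ⊕ y ≈ x' ⊕ y'
    ⊙-cong  : ∀ {x x' y y'} → x ≈ x' → y ≈ y' → x ⊙ y ≈ x' ⊙ y'
    ⋆-cong  : ∀ {x x'} → x ≈ x' → x ⋆ ≈ x' ⋆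
    ⊕-assoc : ∀ x y z → (x ⊕ y) ⊕ z ≈ x ⊕ (y ⊕ z)
    ⊕-comm  : ∀ x y → x ⊕ y ≈ y ⊕ x
    ⊕-idem  : ∀ x → x ⊕ x ≈ x
    ⊕-identʳ : ∀ x → x ⊕ 𝟘 ≈ x
    ⊙-assoc : ∀ x y z → (x ⊙ y) ⊙ z ≈ x ⊙ (y ⊙ z)
    ⊙-identˡ : ∀ x → 𝟙 ⊙ x ≈ x
    ⊙-identʳ : ∀ x → x ⊙ 𝟙 ≈ x
    distribˡ : ∀ x y z → x ⊙ (y ⊕ z) ≈ (x ⊙ y) ⊕ (x ⊙ z)
    distribʳ : ∀ x y z → (y ⊕ z) ⊙ x ≈ (y ⊙ x) ⊕ (z ⊙ x)
    zeroˡ   : ∀ x → 𝟘 ⊙ x ≈ 𝟘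
    zeroʳ   : ∀ x → x ⊙ 𝟘 ≈ 𝟘
    ⋆-unfold : ∀ x → x ⋆ ≈ 𝟙 ⊕ x ⊙ x ⋆
    commute : ∀ {y y'} → y ∼ y' → gen y ⊙ gen y' ≈ gen y' ⊙ gen y

  infix 4 _≤_
  _≤_ : Term Y → Term Y → Set
  x ≤ y = x ⊕ y ≈ y

data Dbl (Y : Set) : Set where
  l r : Y → Dbl Y

data DblRel {Y : Set} (_∼_ : Y → Y → Set) : Dbl Y → Dbl Y → Set where
  lr : ∀ y y' → DblRel _∼_ (l y) (r y')
  rl : ∀ y y' → DblRel _∼_ (r y) (l y')
  ll : ∀ {y y'} → y ∼ y' → DblRel _∼_ (l y) (l y')
  rr : ∀ {y y'} → y ∼ y' → DblRel _∼_ (r y) (r y')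

data Reg : Set where
  r₁ r₂ : Reg

data Instr (Q : Set) : Set where
  Inc  : Reg → Q → Instr Q
  If   : Reg → Q → Q → Instr Q
  Halt : Fin 2 → Instr Q

record TwoCounterMachine : Set where
  field
    k     : ℕ
    q̇     : Fin k
    ι     : Fin k → Instr (Fin k)

open TwoCounterMachine public

data Sym (Q : Set) : Set where
  st : Q → Sym Q
  a b : Sym Q
  c : Fin 2 → Sym Q

ΣM : TwoCounterMachine → Set
ΣM M = Sym (Fin (k M))

_∼Σ_ : ∀ {A : Set} → A → A → Set
x ∼Σ y = x ≡ y

_∼Σ̈_ : ∀ {A : Set} → Dbl A → Dbl A → Set
_∼Σ̈_ = DblRel _∼Σ_

T̈ : TwoCounterMachine → Set
T̈ M = Term (Dbl (ΣM M))

infix 4 _≤̈_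
_≤̈_ : ∀ {A : Set} → Term (Dbl A) → Term (Dbl A) → Set
_≤̈_ = _≤_ _∼Σ̈_

-- Strings (𝒮Σ_M = free monoid, since Σ_M is discrete) and their images

word : ∀ {Y : Set} → List Y → Term Y
word []       = 𝟙
word (y ∷ ys) = gen y ⊙ word ys

_ₗ : ∀ {A : Set} → List A → Term (Dbl A)
s ₗ = word (Data.List.map l s)

_ᵣ : ∀ {A : Set} → List A → Term (Dbl A)
s ᵣ = word (Data.List.map r s)

sumFin : ∀ {Y : Set} (n : ℕ) → (Fin n → Term Y) → Term Y
sumFin zero    f = 𝟘
sumFin (suc n) f = f Fin.zero ⊕ sumFin n (λ i → f (Fin.suc i))

module _ {Q : Set} where
  private
    gl gr : Sym Q → Term (Dbl (Sym Q))
    gl x = gen (l x)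
    gr x = gen (r x)
    AA BB : Term (Dbl (Sym Q))
    AA = (gl a ⊙ gr a) ⋆
    BB = (gl b ⊙ gr b) ⋆

  ⟦_⟧ : Instr Q → Term (Dbl (Sym Q))
  ⟦ Inc r₁ q ⟧     = gr a ⊙ AA ⊙ BB ⊙ gr (st q)
  ⟦ Inc r₂ q ⟧     = AA ⊙ gr b ⊙ BB ⊙ gr (st q)
  ⟦ If r₁ q₁ q₂ ⟧  = BB ⊙ gr (st q₁) ⊕ gl a ⊙ AA ⊙ BB ⊙ gr (st q₂)
  ⟦ If r₂ q₁ q₂ ⟧  = AA ⊙ gr (st q₁) ⊕ AA ⊙ gl b ⊙ BB ⊙ gr (st q₂)
  ⟦ Halt x ⟧       = gr (c x)

  conf : ℕ → ℕ → Q → List (Sym Q)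
  conf n m q = replicate n a ++ replicate m b ++ (st q ∷ [])

  ⟦_⟧f : Instr Q → ℕ → ℕ → List (Sym Q)
  ⟦ Inc r₁ q ⟧f n m          = conf (suc n) m q
  ⟦ Inc r₂ q ⟧f n m          = conf n (suc m) q
  ⟦ If r₁ q₁ q₂ ⟧f zero m    = conf zero m q₁
  ⟦ If r₁ q₁ q₂ ⟧f (suc p) m = conf p m q₂
  ⟦ If r₂ q₁ q₂ ⟧f n zero    = conf n zero q₁
  ⟦ If r₂ q₁ q₂ ⟧f n (suc p) = conf n p q₂
  ⟦ Halt x ⟧f n m            = c x ∷ []

R : (M : TwoCounterMachine) → T̈ M
R M = sumFin (k M) (λ q → ⟦ ι M q ⟧ ⊙ gen (l (st q)))

_⟶[_]_ : ∀ {A : Set} → List A → Term (Dbl A) → List A → Set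
s ⟶[ e ] s' = (s ₗ) ⊙ (s' ᵣ) ≤̈ e

module Submission where

-- Read a term over the doubled alphabet as a language of pairs of strings,
-- y_l and y_r appending y to the left resp. right component.  Languages of
-- pairs form a pre-Kleene algebra in which every y_l commutes with every y'_r,
-- so this is a model of 𝒯Σ̈_M, and s →_{R_M} s' puts (s , s') into the
-- language of ⟦ι(q)⟧ q_l for some q.  The stars (a_l a_r)* and (b_l b_r)* only
-- contain the pairs (aⁿ , aⁿ) and (bᵐ , bᵐ), which pins s down as aⁿbᵐq and
-- s' as ⟦ι(q)⟧_f(n, m).

open import Defs
open import Level using (0ℓ)
open import Data.Nat using (ℕ; zero; suc)
open import Data.Fin using (Fin)
open import Data.List using (List; []; _∷_; _++_; replicate)
open import Data.List.Properties using (++-assoc; ++-identityʳ)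
open import Data.Product using (_×_; _,_; proj₁; proj₂; ∃-syntax)
open import Data.Sum as Sum using (inj₁; inj₂; [_,_]; swap; assocʳ; assocˡ)
open import Function using (id)
open import Relation.Binary.PropositionalEquality
  using (_≡_; refl; sym; trans; cong; cong₂; subst)
open import Relation.Unary using (Pred; _∈_; ∅; ｛_｝; _∪_; _⊆′_; _≐′_)
open import Relation.Unary.Properties using (≐′-refl; ≐′-sym; ≐′-trans)

module PairLanguages {A : Set} where

  Pair : Set
  Pair = List A × List A

  Lang : Set₁
  Lang = Pred Pair 0ℓ

  ε : Pair
  ε = [] , []

  _∙_ : Pair → Pair → Pair
  (u₁ , u₂) ∙ (v₁ , v₂) = u₁ ++ v₁ , u₂ ++ v₂

  ∙-assoc : ∀ u v w → (u ∙ v) ∙ w ≡ u ∙ (v ∙ w)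
  ∙-assoc (u₁ , u₂) (v₁ , v₂) (w₁ , w₂) = cong₂ _,_ (++-assoc u₁ v₁ w₁) (++-assoc u₂ v₂ w₂)

  ∙-identityʳ : ∀ u → u ∙ ε ≡ u
  ∙-identityʳ (u₁ , u₂) = cong₂ _,_ (++-identityʳ u₁) (++-identityʳ u₂)

  private variable F F' G G' : Lang

  infixl 7 _·_
  _·_ : Lang → Lang → Lang
  (F · G) p = ∃[ u ] ∃[ v ] (p ≡ u ∙ v × F u × G v)

  _^_ : Lang → ℕ → Lang
  F ^ zero  = ｛ ε ｝
  F ^ suc n = F · F ^ n

  Star : Lang → Lang
  Star F p = ∃[ n ] (F ^ n) p

  ·-mono : F ⊆′ F' → G ⊆′ G' → F · G ⊆′ F' · G'
  ·-mono F⊆F' G⊆G' _ (u , v , p≡uv , u∈F , v∈G) = u , v , p≡uv , F⊆F' u u∈F , G⊆G' v v∈G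

  ^-mono : F ⊆′ G → ∀ n → F ^ n ⊆′ G ^ n
  ^-mono F⊆G zero    = λ _ → id
  ^-mono F⊆G (suc n) = ·-mono F⊆G (^-mono F⊆G n)

  Star-mono : F ⊆′ G → Star F ⊆′ Star G
  Star-mono F⊆G p (n , p∈Fⁿ) = n , ^-mono F⊆G n p p∈Fⁿ

  ∪-cong : F ≐′ F' → G ≐′ G' → F ∪ G ≐′ F' ∪ G'
  ∪-cong (F⊆F' , F'⊆F) (G⊆G' , G'⊆G) =
    (λ p → Sum.map (F⊆F' p) (G⊆G' p)) , (λ p → Sum.map (F'⊆F p) (G'⊆G p))

  ·-cong : F ≐′ F' → G ≐′ G' → F · G ≐′ F' · G'
  ·-cong (F⊆F' , F'⊆F) (G⊆G' , G'⊆G) = ·-mono F⊆F' G⊆G' , ·-mono F'⊆F G'⊆G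

  Star-cong : F ≐′ G → Star F ≐′ Star G
  Star-cong (F⊆G , G⊆F) = Star-mono F⊆G , Star-mono G⊆F

  ·-assoc : ∀ F G H → (F · G) · H ≐′ F · (G · H)
  ·-assoc F G H = to , from
    where
    to : (F · G) · H ⊆′ F · (G · H)
    to p (_ , w , p≡uw , (u₁ , u₂ , refl , h₁ , h₂) , hw) =
      u₁ , u₂ ∙ w , trans p≡uw (∙-assoc u₁ u₂ w) , h₁ , (u₂ , w , refl , h₂ , hw)
    from : F · (G · H) ⊆′ (F · G) · H
    from p (u₁ , _ , p≡uv , h₁ , (u₂ , w , refl , h₂ , hw)) =
      u₁ ∙ u₂ , w , trans p≡uv (sym (∙-assoc u₁ u₂ w)) , (u₁ , u₂ , refl , h₁ , h₂) , hw

  ·-identityˡ : ∀ F → ｛ ε ｝ · F ≐′ F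
  ·-identityˡ F = (λ { p (_ , v , p≡v , refl , v∈F) → subst F (sym p≡v) v∈F })
                , (λ p p∈F → ε , p , refl , refl , p∈F)

  ·-identityʳ : ∀ F → F · ｛ ε ｝ ≐′ F
  ·-identityʳ F = (λ { p (u , _ , p≡uε , u∈F , refl) → subst F (sym (trans p≡uε (∙-identityʳ u))) u∈F })
                , (λ p p∈F → p , ε , sym (∙-identityʳ p) , p∈F , refl)

  ·-distribˡ-∪ : ∀ F G H → F · (G ∪ H) ≐′ F · G ∪ F · H
  ·-distribˡ-∪ F G H =
      (λ { p (u , v , e , hu , inj₁ hv) → inj₁ (u , v , e , hu , hv)
         ; p (u , v , e , hu , inj₂ hv) → inj₂ (u , v , e , hu , hv) })
    , (λ p → [ ·-mono (λ _ → id) (λ _ → inj₁) p , ·-mono (λ _ → id) (λ _ → inj₂) p ])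

  ·-distribʳ-∪ : ∀ F G H → (G ∪ H) · F ≐′ G · F ∪ H · F
  ·-distribʳ-∪ F G H =
      (λ { p (u , v , e , inj₁ hu , hv) → inj₁ (u , v , e , hu , hv)
         ; p (u , v , e , inj₂ hu , hv) → inj₂ (u , v , e , hu , hv) })
    , (λ p → [ ·-mono (λ _ → inj₁) (λ _ → id) p , ·-mono (λ _ → inj₂) (λ _ → id) p ])

  ·-zeroˡ : ∀ F → ∅ · F ≐′ ∅
  ·-zeroˡ F = (λ { p (_ , _ , _ , () , _) }) , λ _ ()

  ·-zeroʳ : ∀ F → F · ∅ ≐′ ∅
  ·-zeroʳ F = (λ { p (_ , _ , _ , _ , ()) }) , λ _ ()

  Star-unfold : ∀ F → Star F ≐′ ｛ ε ｝ ∪ F · Star F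
  Star-unfold F =
      (λ { p (zero , p≡ε) → inj₁ p≡ε
         ; p (suc n , (u , v , e , hu , hv)) → inj₂ (u , v , e , hu , (n , hv)) })
    , (λ { p (inj₁ p≡ε) → zero , p≡ε
         ; p (inj₂ (u , v , e , hu , (n , hv))) → suc n , (u , v , e , hu , hv) })

  ⟪_⟫ : Term (Dbl A) → Lang
  ⟪ gen (l x) ⟫ = ｛ x ∷ [] , [] ｝
  ⟪ gen (r x) ⟫ = ｛ [] , x ∷ [] ｝
  ⟪ 𝟘 ⟫         = ∅
  ⟪ 𝟙 ⟫         = ｛ ε ｝
  ⟪ x ⊕ y ⟫     = ⟪ x ⟫ ∪ ⟪ y ⟫
  ⟪ x ⊙ y ⟫     = ⟪ x ⟫ · ⟪ y ⟫
  ⟪ x ⋆ ⟫       = Star ⟪ x ⟫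

  ⟪⟫-commute : ∀ {x y} → x ∼Σ̈ y → ⟪ gen x ⊙ gen y ⟫ ≐′ ⟪ gen y ⊙ gen x ⟫
  ⟪⟫-commute (lr y y') = (λ { p (_ , _ , e , refl , refl) → _ , _ , e , refl , refl })
                       , (λ { p (_ , _ , e , refl , refl) → _ , _ , e , refl , refl })
  ⟪⟫-commute (rl y y') = (λ { p (_ , _ , e , refl , refl) → _ , _ , e , refl , refl })
                       , (λ { p (_ , _ , e , refl , refl) → _ , _ , e , refl , refl })
  ⟪⟫-commute (ll refl) = ≐′-refl
  ⟪⟫-commute (rr refl) = ≐′-refl

  ⟪⟫-resp-≈ : ∀ {x y} → _≈_ _∼Σ̈_ x y → ⟪ x ⟫ ≐′ ⟪ y ⟫
  ⟪⟫-resp-≈ ≈-refl            = ≐′-refl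
  ⟪⟫-resp-≈ (≈-sym e)         = ≐′-sym (⟪⟫-resp-≈ e)
  ⟪⟫-resp-≈ (≈-trans e f)     = ≐′-trans (⟪⟫-resp-≈ e) (⟪⟫-resp-≈ f)
  ⟪⟫-resp-≈ (⊕-cong e f)      = ∪-cong (⟪⟫-resp-≈ e) (⟪⟫-resp-≈ f)
  ⟪⟫-resp-≈ (⊙-cong e f)      = ·-cong (⟪⟫-resp-≈ e) (⟪⟫-resp-≈ f)
  ⟪⟫-resp-≈ (⋆-cong e)        = Star-cong (⟪⟫-resp-≈ e)
  ⟪⟫-resp-≈ (⊕-assoc x y z)   = (λ _ → assocʳ) , (λ _ → assocˡ)
  ⟪⟫-resp-≈ (⊕-comm x y)      = (λ _ → swap) , (λ _ → swap)
  ⟪⟫-resp-≈ (⊕-idem x)        = (λ _ → [ id , id ]) , (λ _ → inj₁)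
  ⟪⟫-resp-≈ (⊕-identʳ x)      = (λ _ → [ id , (λ ()) ]) , (λ _ → inj₁)
  ⟪⟫-resp-≈ (⊙-assoc x y z)   = ·-assoc ⟪ x ⟫ ⟪ y ⟫ ⟪ z ⟫
  ⟪⟫-resp-≈ (⊙-identˡ x)      = ·-identityˡ ⟪ x ⟫
  ⟪⟫-resp-≈ (⊙-identʳ x)      = ·-identityʳ ⟪ x ⟫
  ⟪⟫-resp-≈ (distribˡ x y z)  = ·-distribˡ-∪ ⟪ x ⟫ ⟪ y ⟫ ⟪ z ⟫
  ⟪⟫-resp-≈ (distribʳ x y z)  = ·-distribʳ-∪ ⟪ x ⟫ ⟪ y ⟫ ⟪ z ⟫
  ⟪⟫-resp-≈ (zeroˡ x)         = ·-zeroˡ ⟪ x ⟫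
  ⟪⟫-resp-≈ (zeroʳ x)         = ·-zeroʳ ⟪ x ⟫
  ⟪⟫-resp-≈ (⋆-unfold x)      = Star-unfold ⟪ x ⟫
  ⟪⟫-resp-≈ (commute y∼y')    = ⟪⟫-commute y∼y'

  ⟪⟫-mono-≤ : ∀ {x y} → x ≤̈ y → ⟪ x ⟫ ⊆′ ⟪ y ⟫
  ⟪⟫-mono-≤ x+y≈y p p∈x = proj₁ (⟪⟫-resp-≈ x+y≈y) p (inj₁ p∈x)

  ₗ-∈⟪⟫ : ∀ s → (s , []) ∈ ⟪ s ₗ ⟫
  ₗ-∈⟪⟫ []       = refl
  ₗ-∈⟪⟫ (y ∷ ys) = _ , _ , refl , refl , ₗ-∈⟪⟫ ys

  ᵣ-∈⟪⟫ : ∀ s → ([] , s) ∈ ⟪ s ᵣ ⟫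
  ᵣ-∈⟪⟫ []       = refl
  ᵣ-∈⟪⟫ (y ∷ ys) = _ , _ , refl , refl , ᵣ-∈⟪⟫ ys

  ⟶⇒∈⟪⟫ : ∀ {s s' e} → s ⟶[ e ] s' → (s , s') ∈ ⟪ e ⟫
  ⟶⇒∈⟪⟫ {s} {s'} s⟶s' =
    ⟪⟫-mono-≤ s⟶s' _ ((s , []) , ([] , s') , cong (_, s') (sym (++-identityʳ s)) , ₗ-∈⟪⟫ s , ᵣ-∈⟪⟫ s')

  ∈⟪sumFin⟫ : ∀ n (f : Fin n → Term (Dbl A)) {p} → p ∈ ⟪ sumFin n f ⟫ → ∃[ i ] p ∈ ⟪ f i ⟫
  ∈⟪sumFin⟫ (suc n) f (inj₁ p∈f0) = Fin.zero , p∈f0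
  ∈⟪sumFin⟫ (suc n) f (inj₂ p∈rest) with ∈⟪sumFin⟫ n (λ i → f (Fin.suc i)) p∈rest
  ... | i , p∈fi = Fin.suc i , p∈fi

  ∈⟪diagonal⟫^ : ∀ x n {p} → p ∈ ⟪ gen (l x) ⊙ gen (r x) ⟫ ^ n → p ≡ (replicate n x , replicate n x)
  ∈⟪diagonal⟫^ x zero    p≡ε = sym p≡ε
  ∈⟪diagonal⟫^ x (suc n) (_ , v , p≡xv , (_ , _ , refl , refl , refl) , v∈xⁿ)
    with refl ← ∈⟪diagonal⟫^ x n v∈xⁿ = p≡xv

open PairLanguages

∈⟪⟦⟧⟫⇒⟦⟧f : ∀ {Q} (i : Instr Q) {u : List (Sym Q) × List (Sym Q)} → u ∈ ⟪ ⟦ i ⟧ ⟫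
  → ∃[ n ] ∃[ m ] (proj₁ u ≡ replicate n a ++ replicate m b × proj₂ u ≡ ⟦ i ⟧f n m)
∈⟪⟦⟧⟫⇒⟦⟧f (Inc r₁ q) (_ , _ , refl , (_ , _ , refl , (_ , _ , refl , refl , (n , aaⁿ)) , (m , bbᵐ)) , refl)
  with refl ← ∈⟪diagonal⟫^ a n aaⁿ | refl ← ∈⟪diagonal⟫^ b m bbᵐ
  = n , m , ++-identityʳ _ , ++-assoc (a ∷ replicate n a) (replicate m b) _
∈⟪⟦⟧⟫⇒⟦⟧f (Inc r₂ q) (_ , _ , refl , (_ , _ , refl , (_ , _ , refl , (n , aaⁿ) , refl) , (m , bbᵐ)) , refl)
  with refl ← ∈⟪diagonal⟫^ a n aaⁿ | refl ← ∈⟪diagonal⟫^ b m bbᵐ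
  = n , m , trans (++-identityʳ _) (cong (_++ replicate m b) (++-identityʳ (replicate n a)))
  , trans (++-assoc (replicate n a ++ b ∷ []) (replicate m b) _) (++-assoc (replicate n a) (b ∷ []) _)
∈⟪⟦⟧⟫⇒⟦⟧f (If r₁ q₁ q₂) (inj₁ (_ , _ , refl , (m , bbᵐ) , refl))
  with refl ← ∈⟪diagonal⟫^ b m bbᵐ
  = zero , m , ++-identityʳ _ , refl
∈⟪⟦⟧⟫⇒⟦⟧f (If r₁ q₁ q₂) (inj₂ (_ , _ , refl , (_ , _ , refl , (_ , _ , refl , refl , (n , aaⁿ)) , (m , bbᵐ)) , refl))
  with refl ← ∈⟪diagonal⟫^ a n aaⁿ | refl ← ∈⟪diagonal⟫^ b m bbᵐ
  = suc n , m , ++-identityʳ _ , ++-assoc (replicate n a) (replicate m b) _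
∈⟪⟦⟧⟫⇒⟦⟧f (If r₂ q₁ q₂) (inj₁ (_ , _ , refl , (n , aaⁿ) , refl))
  with refl ← ∈⟪diagonal⟫^ a n aaⁿ
  = n , zero , refl , refl
∈⟪⟦⟧⟫⇒⟦⟧f (If r₂ q₁ q₂) (inj₂ (_ , _ , refl , (_ , _ , refl , (_ , _ , refl , (n , aaⁿ) , refl) , (m , bbᵐ)) , refl))
  with refl ← ∈⟪diagonal⟫^ a n aaⁿ | refl ← ∈⟪diagonal⟫^ b m bbᵐ
  = n , suc m , trans (++-identityʳ _) (++-assoc (replicate n a) (b ∷ []) (replicate m b))
  , trans (++-assoc (replicate n a ++ []) (replicate m b) _) (cong (_++ _) (++-identityʳ (replicate n a)))
∈⟪⟦⟧⟫⇒⟦⟧f (Halt x) refl = zero , zero , refl , refl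

mainTheorem8 : (M : TwoCounterMachine) (s s' : List (ΣM M))
    → s ⟶[ R M ] s'
    → ∃[ n ] ∃[ m ] ∃[ q ] (s ≡ conf n m q × s' ≡ ⟦ ι M q ⟧f n m)
mainTheorem8 M s s' s⟶s'
  with q , (u , _ , ss'≡uq , u∈⟦ιq⟧ , refl) ← ∈⟪sumFin⟫ (k M) _ (⟶⇒∈⟪⟫ s⟶s')
  with n , m , u₁≡aⁿbᵐ , u₂≡⟦ιq⟧f ← ∈⟪⟦⟧⟫⇒⟦⟧f (ι M q) u∈⟦ιq⟧
  = n , m , q
  , trans (cong proj₁ ss'≡uq) (trans (cong (_++ _) u₁≡aⁿbᵐ) (++-assoc (replicate n a) (replicate m b) _))
  , trans (cong proj₂ ss'≡uq) (trans (++-identityʳ _) u₂≡⟦ιq⟧f)
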